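{- Let $\sigma=(X,\Lambda,\alpha,\iota)$ be a signature and $\mathcal{M}^\sigma$ its finitary standard model. Then $\mathcal{M}^\sigma$ is a Kripke model (over the label set $\iota$); it is a D model if $X=D$; a T model if $X=T$; a B model if $X=B$; an S4 model if $X=S4$; and an S5 model if $X=S5$.
   Context: Fix a countably infinite set $P$ of propositional variables and an at most countable set $\mathbb{I}$ of primitive types. An index is a finite nonempty subset of $\mathbb{I}$. The language $\mathcal{L}^{\cap\cup}$ is given by $\phi ::= p \mid \neg\phi \mid (\phi\to\phi) \mid \Box_i\phi \mid [\cap_I]\phi \mid [\cup^+_I]\phi$ with $p\in P$, $i\in\mathbb{I}$, $I$ an index. A Kripke model over a label set $\iota$ is $(S,R,V)$, $S\neq\emptyset$, $R_i\subseteq S\times S$ for $i\in\iota$, $V:P\to\wp(S)$; it is a D (resp. T, B, S4, S5) model if every $R_i$ is serial (resp. reflexive; reflexive and symmetric; reflexive and transitive; an equivalence relation). Axiomatizations (schemes over $\mathcal{L}^{\cap\cup}$, for all $i\in\mathbb{I}$, indices $I,J$): $\Lambda_K$ consists of all propositional tautologies, modus ponens, (K) $\Box_i(\phi\to\psi)\to(\Box_i\phi\to\Box_i\psi)$, (N) from $\phi$ infer $\Box_i\phi$, (K$\cap$) $[\cap_I](\phi\to\psi)\to([\cap_I]\phi\to[\cap_I]\psi)$, (N$\cap$) from $\phi$ infer $[\cap_I]\phi$, ($\cap$1) $\Box_i\phi\leftrightarrow[\cap_{\{i\}}]\phi$, ($\cap$2) $[\cap_I]\phi\to[\cap_J]\phi$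 if $I\subseteq J$, (K$\cup$) $[\cup^+_I](\phi\to\psi)\to([\cup^+_I]\phi\to[\cup^+_I]\psi)$, ($\cup$1) $[\cup^+_I]\phi\to\Box_i(\phi\wedge[\cup^+_I]\phi)$ if $i\in I$, ($\cup$2) from $\phi\to\bigwedge_{i\in I}\Box_i(\phi\wedge\psi)$ infer $\phi\to[\cup^+_I]\psi$. Further $\Lambda_D=\Lambda_K+$(D) $\Box_i\phi\to\neg\Box_i\neg\phi$; $\Lambda_T=\Lambda_K+$(T) $\Box_i\phi\to\phi$ $+$(T$\cap$) $[\cap_I]\phi\to\phi$; $\Lambda_B=\Lambda_T+$(B) $\neg\phi\to\Box_i\neg\Box_i\phi$ $+$(B$\cap$) $\neg\phi\to[\cap_I]\neg[\cap_I]\phi$; $\Lambda_{S4}=\Lambda_T+$(4) $\Box_i\phi\to\Box_i\Box_i\phi$ $+$(4$\cap$) $[\cap_I]\phi\to[\cap_I][\cap_I]\phi$; $\Lambda_{S5}=\Lambda_T+$(5) $\neg\Box_i\phi\to\Box_i\neg\Box_i\phi$ $+$(5$\cap$) $\neg[\cap_I]\phi\to[\cap_I]\neg[\cap_I]\phi$. A signature is $\sigma=(X,\Lambda,\alpha,\iota)$ with $X\in\{K,D,T,B,S4,S5\}$, $\Lambda=\Lambda_X$, $\alpha\in\mathcal{L}^{\cap\cup}$, and $\iota$ an index such that every index occurring in $\alpha$ is a subset of $\iota$. The closure $cl(\sigma)$ is the least set of formulas such that: $\alpha\in cl(\sigma)$; it is closed under subformulas; if $\phi\in cl(\sigma)$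 does not start with $\neg$ then $\neg\phi\in cl(\sigma)$; for $i\in\iota$, $[\cap_{\{i\}}]\phi\in cl(\sigma)$ iff $\Box_i\phi\in cl(\sigma)$; if $I\subset J\subseteq\iota$ and $[\cap_I]\phi\in cl(\sigma)$ then $[\cap_J]\phi\in cl(\sigma)$; if $I,J\subseteq\iota$ are indices with $I\cap J\neq\emptyset$ and $[\cup^+_I]\phi\in cl(\sigma)$ then $[\cap_J][\cup^+_I]\phi\in cl(\sigma)$. $\mathrm{MCS}^\sigma$ is the set of maximal $\Lambda$-consistent subsets of $cl(\sigma)$. Finitary canonical relation $\rhd_I$ ($I\subseteq\iota$ an index) on $\mathrm{MCS}^\sigma$: if $X\in\{K,D,T\}$, $\Phi\rhd_I\Psi$ iff $\{\phi\mid[\cap_I]\phi\in\Phi\}\subseteq\Psi$; if $X=B$, iff $\{\phi\mid[\cap_I]\phi\in\Phi\}\subseteq\Psi$ and $\{\phi\mid[\cap_I]\phi\in\Psi\}\subseteq\Phi$; if $X=S4$, iff $\{[\cap_I]\phi\mid[\cap_I]\phi\in\Phi\}\subseteq\{[\cap_I]\phi\mid[\cap_I]\phi\in\Psi\}$; if $X=S5$, iff $\{[\cap_I]\phi\mid[\cap_I]\phi\in\Phi\}=\{[\cap_I]\phi\mid[\cap_I]\phi\in\Psi\}$. A canonical path for $\Lambda$ in $cl(\sigma)$ is a sequence $\langle\Phi_0,I_0,\Phi_1,\ldots,I_{n-1},\Phi_n\rangle$ ($n\ge0$) with $\Phi_x\in\mathrm{MCS}^\sigma$, $I_x\subseteq\iota$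 indices, $\Phi_x\rhd_{I_x}\Phi_{x+1}$. For such paths $s=\langle\Phi_0,I_0,\ldots,\Phi_m\rangle$, $t=\langle\Psi_0,J_0,\ldots,\Psi_n\rangle$: $s$ is an initial segment of $t$ if $m\le n$, $\Phi_x=\Psi_x$ ($x\le m$), $I_y=J_y$ ($y<m$); then $t$ extends $s$ with $\langle J_m,\Psi_{m+1},\ldots,J_{n-1},\Psi_n\rangle$, and $t\setminus s=\langle\Psi_m,J_m,\ldots,\Psi_n\rangle$; $\mathrm{tail}(s)=\Phi_m$; a path is an $i$-path if $i$ belongs to all its indices. Standard relations $\mathcal{R}^\sigma_i$ ($i\in\iota$): if $X\in\{K,D\}$, $(s,t)\in\mathcal{R}^\sigma_i$ iff $t$ extends $s$ with $\langle I,\Phi\rangle$ for some $\Phi\in\mathrm{MCS}^\sigma$ and index $I$ with $i\in I\subseteq\iota$; if $X=T$, iff $t=s$ or the previous condition; if $X=B$, iff $t=s$, or $s$ extends $t$ with such an $\langle I,\Phi\rangle$, or $t$ extends $s$ with such an $\langle I,\Phi\rangle$; if $X=S4$, iff $s$ is an initial segment of $t$ and $t\setminus s$ is an $i$-path; if $X=S5$, iff $s,t$ have a common initial segment $u$ with $s\setminus u$ and $t\setminus u$ both $i$-paths. The finitary standard model $\mathcal{M}^\sigma=(\mathcal{S},\mathcal{R},\mathcal{V})$: $\mathcal{S}$ is the set of all canonical paths for $\Lambda$ in $cl(\sigma)$, $\mathcal{R}_i=\mathcal{R}^\sigma_i$ for $i\in\iota$, $\mathcal{V}(p)=\{s\mid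 p\in\mathrm{tail}(s)\}$. -}

-- The set 𝕀 of primitive types is an arbitrary type with an injection into ℕ
-- (i.e. an at most countable set); propositional variables are ℕ (countably infinite).
module Defs where

open import Data.Nat using (ℕ; _<_)
open import Relation.Binary.PropositionalEquality using (_≡_)

module L (𝕀 : Set) (enc : 𝕀 → ℕ) (enc-inj : ∀ {x y} → enc x ≡ enc y → x ≡ y) where

  open import Data.Bool using (Bool; true; false; not; _∨_; T)
  open import Data.Unit using (⊤; tt)
  open import Data.Empty using (⊥)
  open import Data.Product using (Σ; ∃; _×_; _,_)
  open import Data.Sum using (_⊎_)
  open import Data.List using (List; []; _∷_)
  open import Data.List.Membership.Propositional using (_∈_)
  open import Data.List.Relation.Unary.All using (All)
  open import Relation.Nullary using (¬_)
  open import Relation.Binary using (Reflexive; Symmetric; Transitive; IsEquivalence)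

  -- Indices: finite nonempty subsets of 𝕀, represented canonically as
  -- nonempty lists strictly increasing w.r.t. enc (the sortedness proof is
  -- irrelevant, so an index is determined by its elements).

  Sorted : List 𝕀 → Set
  Sorted []           = ⊤
  Sorted (x ∷ [])     = ⊤
  Sorted (x ∷ y ∷ l)  = (enc x < enc y) × Sorted (y ∷ l)

  record Index : Set where
    constructor idx
    field
      hd : 𝕀
      tl : List 𝕀
      .sorted : Sorted (hd ∷ tl)
  open Index public

  infix 4 _∈ᵢ_ _⊆ᵢ_ _⊂ᵢ_

  _∈ᵢ_ : 𝕀 → Index → Set
  i ∈ᵢ I = i ∈ (hd I ∷ tl I)

  _⊆ᵢ_ : Index → Index → Set
  I ⊆ᵢ J = ∀ {i} → i ∈ᵢ I → i ∈ᵢ J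

  _⊂ᵢ_ : Index → Index → Set
  I ⊂ᵢ J = (I ⊆ᵢ J) × ¬ (J ⊆ᵢ I)

  Meets : Index → Index → Set
  Meets I J = ∃ λ i → (i ∈ᵢ I) × (i ∈ᵢ J)

  ｛_｝ : 𝕀 → Index
  ｛ i ｝ = idx i [] tt

  infixr 6 _⇒_
  infix 7 ~_

  data Fm : Set where
    var   : ℕ → Fm
    ~_    : Fm → Fm
    _⇒_   : Fm → Fm → Fm
    □     : 𝕀 → Fm → Fm
    ∩[_]  : Index → Fm → Fm
    ∪⁺[_] : Index → Fm → Fm

  infixr 5 _∧_
  _∧_ : Fm → Fm → Fm
  φ ∧ ψ = ~ (φ ⇒ ~ ψ)

  _⇔_ : Fm → Fm → Fm
  φ ⇔ ψ = (φ ⇒ ψ) ∧ (ψ ⇒ φ)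

  ⊤f : Fm
  ⊤f = var 0 ⇒ var 0

  ⋀ᵢ : Index → (𝕀 → Fm) → Fm
  ⋀ᵢ I f = go (hd I) (tl I)
    where
    go : 𝕀 → List 𝕀 → Fm
    go x []      = f x
    go x (y ∷ l) = f x ∧ go y l

  ⋀ : List Fm → Fm
  ⋀ []      = ⊤f
  ⋀ (φ ∷ l) = φ ∧ ⋀ l

  -- Propositional tautologies: true under every Boolean valuation of the
  -- maximal non-Boolean subformulas (variables and modal formulas).

  eval : (Fm → Bool) → Fm → Bool
  eval v (~ φ)   = not (eval v φ)
  eval v (φ ⇒ ψ) = not (eval v φ) ∨ eval v ψ
  eval v φ       = v φ

  Taut : Fm → Set
  Taut φ = ∀ (v : Fm → Bool) → eval v φ ≡ true

  data Sys : Set where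
    K D T′ B S4 S5 : Sys

  data ExtT : Sys → Set where
    eT : ExtT T′
    eB : ExtT B
    eS4 : ExtT S4
    eS5 : ExtT S5

  data _⊢_ (X : Sys) : Fm → Set where
    taut  : ∀ {φ} → Taut φ → X ⊢ φ
    mp    : ∀ {φ ψ} → X ⊢ (φ ⇒ ψ) → X ⊢ φ → X ⊢ ψ
    axK   : ∀ {i φ ψ} → X ⊢ (□ i (φ ⇒ ψ) ⇒ (□ i φ ⇒ □ i ψ))
    ruleN : ∀ {i φ} → X ⊢ φ → X ⊢ □ i φ
    axK∩  : ∀ {I φ ψ} → X ⊢ (∩[ I ] (φ ⇒ ψ) ⇒ (∩[ I ] φ ⇒ ∩[ I ] ψ))
    ruleN∩ : ∀ {I φ} → X ⊢ φ → X ⊢ ∩[ I ] φ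
    ax∩1  : ∀ {i φ} → X ⊢ (□ i φ ⇔ ∩[ ｛ i ｝ ] φ)
    ax∩2  : ∀ {I J φ} → I ⊆ᵢ J → X ⊢ (∩[ I ] φ ⇒ ∩[ J ] φ)
    axK∪  : ∀ {I φ ψ} → X ⊢ (∪⁺[ I ] (φ ⇒ ψ) ⇒ (∪⁺[ I ] φ ⇒ ∪⁺[ I ] ψ))
    ax∪1  : ∀ {I i φ} → i ∈ᵢ I → X ⊢ (∪⁺[ I ] φ ⇒ □ i (φ ∧ ∪⁺[ I ] φ))
    rule∪2 : ∀ {I φ ψ} → X ⊢ (φ ⇒ ⋀ᵢ I (λ i → □ i (φ ∧ ψ))) → X ⊢ (φ ⇒ ∪⁺[ I ] ψ)
    axD   : ∀ {i φ} → X ≡ D → X ⊢ (□ i φ ⇒ ~ □ i (~ φ))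
    axT   : ∀ {i φ} → ExtT X → X ⊢ (□ i φ ⇒ φ)
    axT∩  : ∀ {I φ} → ExtT X → X ⊢ (∩[ I ] φ ⇒ φ)
    axB   : ∀ {i φ} → X ≡ B → X ⊢ (~ φ ⇒ □ i (~ □ i φ))
    axB∩  : ∀ {I φ} → X ≡ B → X ⊢ (~ φ ⇒ ∩[ I ] (~ ∩[ I ] φ))
    ax4   : ∀ {i φ} → X ≡ S4 → X ⊢ (□ i φ ⇒ □ i (□ i φ))
    ax4∩  : ∀ {I φ} → X ≡ S4 → X ⊢ (∩[ I ] φ ⇒ ∩[ I ] (∩[ I ] φ))
    ax5   : ∀ {i φ} → X ≡ S5 → X ⊢ (~ □ i φ ⇒ □ i (~ □ i φ))
    ax5∩  : ∀ {I φ} → X ≡ S5 → X ⊢ (~ ∩[ I ] φ ⇒ ∩[ I ] (~ ∩[ I ] φ))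

  Consistent : Sys → (Fm → Set) → Set
  Consistent X Γ = ∀ (l : List Fm) → All Γ l → ¬ (X ⊢ (~ ⋀ l))

  IdxIn : Index → Fm → Set
  IdxIn ι (var p)     = ⊤
  IdxIn ι (~ φ)       = IdxIn ι φ
  IdxIn ι (φ ⇒ ψ)     = IdxIn ι φ × IdxIn ι ψ
  IdxIn ι (□ i φ)     = IdxIn ι φ
  IdxIn ι (∩[ I ] φ)  = (I ⊆ᵢ ι) × IdxIn ι φ
  IdxIn ι (∪⁺[ I ] φ) = (I ⊆ᵢ ι) × IdxIn ι φ

  record Signature : Set where
    field
      X  : Sys
      α  : Fm
      ι  : Index
      wf : IdxIn ι α
  open Signature public

  data ImmSub : Fm → Fm → Set where
    s~  : ∀ {φ} → ImmSub φ (~ φ)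
    s⇒l : ∀ {φ ψ} → ImmSub φ (φ ⇒ ψ)
    s⇒r : ∀ {φ ψ} → ImmSub ψ (φ ⇒ ψ)
    s□  : ∀ {i φ} → ImmSub φ (□ i φ)
    s∩  : ∀ {I φ} → ImmSub φ (∩[ I ] φ)
    s∪  : ∀ {I φ} → ImmSub φ (∪⁺[ I ] φ)

  NotNeg : Fm → Set
  NotNeg (~ φ) = ⊥
  NotNeg _     = ⊤

  data Cl (σ : Signature) : Fm → Set where
    c-α   : Cl σ (α σ)
    c-sub : ∀ {φ ψ} → Cl σ φ → ImmSub ψ φ → Cl σ ψ
    c-neg : ∀ {φ} → Cl σ φ → NotNeg φ → Cl σ (~ φ)
    c-□∩  : ∀ {i φ} → i ∈ᵢ ι σ → Cl σ (□ i φ) → Cl σ (∩[ ｛ i ｝ ] φ)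
    c-∩□  : ∀ {i φ} → i ∈ᵢ ι σ → Cl σ (∩[ ｛ i ｝ ] φ) → Cl σ (□ i φ)
    c-sup : ∀ {I J φ} → I ⊂ᵢ J → J ⊆ᵢ ι σ → Cl σ (∩[ I ] φ) → Cl σ (∩[ J ] φ)
    c-∪   : ∀ {I J φ} → I ⊆ᵢ ι σ → J ⊆ᵢ ι σ → Meets I J →
            Cl σ (∪⁺[ I ] φ) → Cl σ (∩[ J ] (∪⁺[ I ] φ))

  record MCS (σ : Signature) : Set where
    constructor mcs
    field
      mem  : Fm → Bool
      .sub : ∀ φ → T (mem φ) → Cl σ φ
      .cons : Consistent (X σ) (λ φ → T (mem φ))
      .max : ∀ φ → Cl σ φ → ¬ T (mem φ) →
             ¬ Consistent (X σ) (λ ψ → T (mem ψ) ⊎ ψ ≡ φ)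
  open MCS public

  _∈Φ_ : ∀ {σ} → Fm → MCS σ → Set
  φ ∈Φ Φ = T (mem Φ φ)

  Canon : (σ : Signature) → Index → MCS σ → MCS σ → Set
  Canon σ I Φ Ψ = go (X σ)
    where
    fwd bwd s4 : Set
    fwd = ∀ φ → ∩[ I ] φ ∈Φ Φ → φ ∈Φ Ψ
    bwd = ∀ φ → ∩[ I ] φ ∈Φ Ψ → φ ∈Φ Φ
    s4  = ∀ φ → ∩[ I ] φ ∈Φ Φ → ∩[ I ] φ ∈Φ Ψ
    go : Sys → Set
    go K  = fwd
    go D  = fwd
    go T′ = fwd
    go B  = fwd × bwd
    go S4 = s4
    go S5 = s4 × (∀ φ → ∩[ I ] φ ∈Φ Ψ → ∩[ I ] φ ∈Φ Φ)

  data Path (σ : Signature) : Set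
  tail : ∀ {σ} → Path σ → MCS σ

  data Path σ where
    start : MCS σ → Path σ
    step  : (s : Path σ) (I : Index) .(I⊆ι : I ⊆ᵢ ι σ) (Φ : MCS σ)
            .(r : Canon σ I (tail s) Φ) → Path σ

  tail (start Φ)        = Φ
  tail (step _ _ _ Φ _) = Φ

  data OneStep {σ} (i : 𝕀) : Path σ → Path σ → Set where
    os : ∀ {s I Φ} .{p : I ⊆ᵢ ι σ} .{r : Canon σ I (tail s) Φ} → i ∈ᵢ I → OneStep i s (step s I p Φ r)

  data IExt {σ} (i : 𝕀) : Path σ → Path σ → Set where
    here  : ∀ {s} → IExt i s s
    there : ∀ {s t I Φ} .{p : I ⊆ᵢ ι σ} .{r : Canon σ I (tail t) Φ} → IExt i s t → i ∈ᵢ I → IExt i s (step t I p Φ r)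

  StdRel : (σ : Signature) → 𝕀 → Path σ → Path σ → Set
  StdRel σ i s t = go (X σ)
    where
    go : Sys → Set
    go K  = OneStep i s t
    go D  = OneStep i s t
    go T′ = s ≡ t ⊎ OneStep i s t
    go B  = s ≡ t ⊎ OneStep i t s ⊎ OneStep i s t
    go S4 = IExt i s t
    go S5 = ∃ λ u → IExt i u s × IExt i u t

  record Kripke : Set₁ where
    field
      S : Set
      R : 𝕀 → S → S → Set
      V : ℕ → S → Set
  open Kripke public

  IsKripke : Kripke → Set
  IsKripke M = ¬ ¬ S M

  Serial : ∀ {A : Set} → (A → A → Set) → Set
  Serial {A} R = ∀ (x : A) → ∃ λ y → R x y

  IsDModel IsTModel IsBModel IsS4Model IsS5Model : Index → Kripke → Set
  IsDModel  ι M = IsKripke M × (∀ i → i ∈ᵢ ι → Serial (R M i))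
  IsTModel  ι M = IsKripke M × (∀ i → i ∈ᵢ ι → Reflexive (R M i))
  IsBModel  ι M = IsKripke M × (∀ i → i ∈ᵢ ι → Reflexive (R M i) × Symmetric (R M i))
  IsS4Model ι M = IsKripke M × (∀ i → i ∈ᵢ ι → Reflexive (R M i) × Transitive (R M i))
  IsS5Model ι M = IsKripke M × (∀ i → i ∈ᵢ ι → IsEquivalence (R M i))

  StdModel : Signature → Kripke
  StdModel σ = record
    { S = Path σ
    ; R = StdRel σ
    ; V = λ p s → var p ∈Φ tail s
    }

-- Only the D case needs an argument. Excluded middle and an injective coding of formulas
-- into ℕ give a Lindenbaum lemma: every consistent subset of cl(σ) extends to an element of
-- MCS^σ. The empty set is consistent, since every theorem holds at a single reflexive point,
-- so there are paths and the model is nonempty. For seriality in a D model, K∩, (∩1) and (D)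
-- show that {φ | [∩_{i}]φ ∈ Φ} is consistent whenever Φ is, and its extension is a
-- ▷_{i}-successor of Φ. The frame conditions of T, B, S4 and S5 are built into the standard
-- relations; S5 transitivity holds because two initial segments of a path are comparable.
module Submission where

open import Data.Nat using (ℕ)
open import Data.Product using (_×_)
open import Relation.Binary.PropositionalEquality using (_≡_)
open import Axiom.ExcludedMiddle using (ExcludedMiddle)
open import Level using (0ℓ)
import Defs

open import Data.Nat using (zero; suc; _⊔_; _≤′_; ≤′-refl; ≤′-step)
open import Data.Nat.Properties using (m≤m⊔n; m≤n⊔m; ≤⇒≤′)
open import Data.Nat.Binary using (ℕᵇ; zero; 2[1+_]; 1+[2_]; toℕ)
open import Data.Nat.Binary.Properties using (toℕ-injective; 2[1+_]-injective; 1+[2_]-injective)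
open import Data.Bool using (Bool; true; false; not; _∨_; T) renaming (_∧_ to _∧ᵇ_)
open import Data.Bool.Properties using (T-∧; T-≡; ∨-inverseˡ)
open import Data.Empty using (⊥-elim)
open import Data.Fin as Fin using (Fin)
open import Data.Vec using (Vec; []; _∷_; lookup; map)
open import Data.Vec.Properties using (lookup-map)
open import Data.List as List using (List; []; _∷_)
open import Data.List.Properties using (∷-injective)
open import Data.List.Relation.Unary.All as All using (All; []; _∷_)
open import Data.List.Relation.Unary.All.Properties using (map⁺)
open import Data.List.Relation.Unary.Any using (here)
open import Data.Product using (∃; _,_; proj₁; proj₂; uncurry; map₁)
open import Data.Sum as Sum using (_⊎_; inj₁; inj₂)
open import Function using (id; _∘_; Equivalence)
open import Relation.Nullary using (yes; no)
open import Relation.Nullary.Decidable using (⌊_⌋; toWitness; fromWitness)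
open import Relation.Unary using (Pred; _⊆_; _∪_; ∅)
open import Relation.Binary.PropositionalEquality using (refl; sym; trans; cong; cong₂)

module FinitaryStandardModel (𝕀 : Set) (enc : 𝕀 → ℕ) (enc-inj : ∀ {x y} → enc x ≡ enc y → x ≡ y) where
  open Defs.L 𝕀 enc enc-inj

  module Coding where

    -- ℕᵇ is used as a bit string; its constructors are injective and toℕ is a bijection.
    PrefixCode : {A : Set} → (A → ℕᵇ → ℕᵇ) → Set
    PrefixCode {A} c = ∀ {x y : A} {r s} → c x r ≡ c y s → x ≡ y × r ≡ s

    unary : ℕ → ℕᵇ → ℕᵇ
    unary zero    r = 1+[2 r ]
    unary (suc n) r = 2[1+ unary n r ]

    unary-prefix : PrefixCode unary
    unary-prefix {zero}  {zero}  e = refl , 1+[2_]-injective e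
    unary-prefix {suc m} {suc n} e = map₁ (cong suc) (unary-prefix (2[1+_]-injective e))

    list : List 𝕀 → ℕᵇ → ℕᵇ
    list []       r = 1+[2 r ]
    list (x ∷ xs) r = 2[1+ unary (enc x) (list xs r) ]

    list-prefix : PrefixCode list
    list-prefix {[]}     {[]}     e = refl , 1+[2_]-injective e
    list-prefix {x ∷ xs} {y ∷ ys} e with unary-prefix (2[1+_]-injective e)
    ... | enc≡ , e′ with enc-inj enc≡ | list-prefix e′
    ...   | refl | refl , r≡s = refl , r≡s

    Index-≡ : ∀ {I J} → hd I ≡ hd J → tl I ≡ tl J → I ≡ J
    Index-≡ {idx _ _ _} {idx _ _ _} refl refl = refl

    index : Index → ℕᵇ → ℕᵇ
    index I = list (hd I ∷ tl I)

    index-prefix : PrefixCode index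
    index-prefix e with list-prefix e
    ... | I≡J , r≡s = uncurry Index-≡ (∷-injective I≡J) , r≡s

    tag : Fm → ℕ
    tag (var _)     = 0
    tag (~ _)       = 1
    tag (_ ⇒ _)     = 2
    tag (□ _ _)     = 3
    tag (∩[ _ ] _)  = 4
    tag (∪⁺[ _ ] _) = 5

    encode fields : Fm → ℕᵇ → ℕᵇ
    encode φ r = unary (tag φ) (fields φ r)
    fields (var n)     r = unary n r
    fields (~ φ)       r = encode φ r
    fields (φ ⇒ ψ)     r = encode φ (encode ψ r)
    fields (□ i φ)     r = unary (enc i) (encode φ r)
    fields (∩[ I ] φ)  r = index I (encode φ r)
    fields (∪⁺[ I ] φ) r = index I (encode φ r)

    encode-prefix : PrefixCode encode
    fields-prefix : ∀ {φ ψ r s} → tag φ ≡ tag ψ → fields φ r ≡ fields ψ s → φ ≡ ψ × r ≡ s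

    encode-prefix {φ} {ψ} e = uncurry (fields-prefix {φ} {ψ}) (unary-prefix e)

    fields-prefix {var _} {var _} refl e = map₁ (cong var) (unary-prefix e)
    fields-prefix {~ _}   {~ _}   refl e = map₁ (cong ~_) (encode-prefix e)
    fields-prefix {φ ⇒ _} {_ ⇒ _} refl e with encode-prefix e
    ... | refl , e′ = map₁ (cong (φ ⇒_)) (encode-prefix e′)
    fields-prefix {□ _ _} {□ _ _} refl e with unary-prefix e
    ... | enc≡ , e′ with enc-inj enc≡ | encode-prefix e′
    ...   | refl | refl , r≡s = refl , r≡s
    fields-prefix {∩[ I ] _} {∩[ J ] _} refl e with index-prefix {I} {J} e
    ... | refl , e′ = map₁ (cong (∩[ I ])) (encode-prefix e′)
    fields-prefix {∪⁺[ I ] _} {∪⁺[ J ] _} refl e with index-prefix {I} {J} e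
    ... | refl , e′ = map₁ (cong (∪⁺[ I ])) (encode-prefix e′)

    code : Fm → ℕ
    code φ = toℕ (encode φ zero)

    code-injective : ∀ {φ ψ} → code φ ≡ code ψ → φ ≡ ψ
    code-injective e = proj₁ (encode-prefix (toℕ-injective e))

  open Coding using (code; code-injective)

  module OnePointModel where

    -- Every modality is read as the identity, so each modal axiom becomes a propositional
    -- tautology, mostly an instance of φ ⇒ φ.
    ⟦_⟧ : Fm → Bool
    ⟦ var _ ⟧     = true
    ⟦ ~ φ ⟧       = not ⟦ φ ⟧
    ⟦ φ ⇒ ψ ⟧     = not ⟦ φ ⟧ ∨ ⟦ ψ ⟧
    ⟦ □ _ φ ⟧     = ⟦ φ ⟧
    ⟦ ∩[ _ ] φ ⟧  = ⟦ φ ⟧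
    ⟦ ∪⁺[ _ ] φ ⟧ = ⟦ φ ⟧

    eval-⟦⟧ : ∀ φ → eval ⟦_⟧ φ ≡ ⟦ φ ⟧
    eval-⟦⟧ (var _)     = refl
    eval-⟦⟧ (~ φ)       = cong not (eval-⟦⟧ φ)
    eval-⟦⟧ (φ ⇒ ψ)     = cong₂ (λ a b → not a ∨ b) (eval-⟦⟧ φ) (eval-⟦⟧ ψ)
    eval-⟦⟧ (□ _ _)     = refl
    eval-⟦⟧ (∩[ _ ] _)  = refl
    eval-⟦⟧ (∪⁺[ _ ] _) = refl

    ⇒-refl : ∀ φ → ⟦ φ ⇒ φ ⟧ ≡ true
    ⇒-refl φ = ∨-inverseˡ ⟦ φ ⟧

    ⇒-elim : ∀ φ ψ → ⟦ φ ⇒ ψ ⟧ ≡ true → ⟦ φ ⟧ ≡ true → ⟦ ψ ⟧ ≡ true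
    ⇒-elim φ ψ e p with ⟦ φ ⟧
    ... | true = e

    ⇒-intro : ∀ φ ψ → (⟦ φ ⟧ ≡ true → ⟦ ψ ⟧ ≡ true) → ⟦ φ ⇒ ψ ⟧ ≡ true
    ⇒-intro φ ψ f with ⟦ φ ⟧
    ... | false = refl
    ... | true  = f refl

    ∧-diag : ∀ φ → ⟦ φ ⟧ ≡ true → ⟦ φ ∧ φ ⟧ ≡ true
    ∧-diag φ p rewrite p = refl

    ∧-elimʳ : ∀ φ ψ → ⟦ φ ∧ ψ ⟧ ≡ true → ⟦ ψ ⟧ ≡ true
    ∧-elimʳ φ ψ e with ⟦ φ ⟧ | ⟦ ψ ⟧
    ... | true | true = refl

    ⋀ᵢ-head : ∀ I f → ⟦ ⋀ᵢ I f ⟧ ≡ true → ⟦ f (hd I) ⟧ ≡ true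
    ⋀ᵢ-head (idx _ []      _) _ = id
    ⋀ᵢ-head (idx h (_ ∷ _) _) f = first-conjunct ⟦ f h ⟧
      where
      first-conjunct : ∀ a {b} → not (not a ∨ b) ≡ true → a ≡ true
      first-conjunct true _ = refl

    sound : ∀ {X φ} → X ⊢ φ → ⟦ φ ⟧ ≡ true
    sound {φ = φ} (taut t)                = trans (sym (eval-⟦⟧ φ)) (t ⟦_⟧)
    sound (mp {φ} {ψ} d e)                = ⇒-elim φ ψ (sound d) (sound e)
    sound (axK {φ = φ} {ψ})               = ⇒-refl (φ ⇒ ψ)
    sound (ruleN d)                       = sound d
    sound (axK∩ {φ = φ} {ψ})              = ⇒-refl (φ ⇒ ψ)
    sound (ruleN∩ d)                      = sound d
    sound (ax∩1 {φ = φ})                  = ∧-diag (φ ⇒ φ) (⇒-refl φ)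
    sound (ax∩2 {φ = φ} _)                = ⇒-refl φ
    sound (axK∪ {φ = φ} {ψ})              = ⇒-refl (φ ⇒ ψ)
    sound (ax∪1 {φ = φ} _)                = ⇒-intro φ (φ ∧ φ) (∧-diag φ)
    sound (rule∪2 {I} {φ} {ψ} d)          =
      ⇒-intro φ ψ (∧-elimʳ φ ψ ∘ ⋀ᵢ-head I □φ∧ψ ∘ ⇒-elim φ (⋀ᵢ I □φ∧ψ) (sound d))
      where
      □φ∧ψ : 𝕀 → Fm
      □φ∧ψ i = □ i (φ ∧ ψ)
    sound (axD {φ = φ} _)                 = ⇒-intro φ (~ ~ φ) (cong (not ∘ not))
    sound (axT {φ = φ} _)                 = ⇒-refl φ
    sound (axT∩ {φ = φ} _)                = ⇒-refl φ
    sound (axB {φ = φ} _)                 = ⇒-refl (~ φ)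
    sound (axB∩ {φ = φ} _)                = ⇒-refl (~ φ)
    sound (ax4 {φ = φ} _)                 = ⇒-refl φ
    sound (ax4∩ {φ = φ} _)                = ⇒-refl φ
    sound (ax5 {i} {φ} _)                 = ⇒-refl (~ □ i φ)
    sound (ax5∩ {I} {φ} _)                = ⇒-refl (~ ∩[ I ] φ)

    ∅-consistent : ∀ {X} → Consistent X ∅
    ∅-consistent [] [] ⊢¬⊤ with sound ⊢¬⊤
    ... | ()

  open OnePointModel using (∅-consistent)

  module Tautologies where

    infixr 6 _⇒ˢ_
    infixr 7 _∧ˢ_
    infix 8 ~ˢ_
    infix 25 _⟨_⟩

    data Schema (n : ℕ) : Set where
      ‹_›  : Fin n → Schema n
      ~ˢ_  : Schema n → Schema n
      _⇒ˢ_ : Schema n → Schema n → Schema n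

    _∧ˢ_ : ∀ {n} → Schema n → Schema n → Schema n
    s ∧ˢ t = ~ˢ (s ⇒ˢ ~ˢ t)

    p₀ : ∀ {n} → Schema (suc n)
    p₀ = ‹ Fin.zero ›
    p₁ : ∀ {n} → Schema (suc (suc n))
    p₁ = ‹ Fin.suc Fin.zero ›
    p₂ : ∀ {n} → Schema (suc (suc (suc n)))
    p₂ = ‹ Fin.suc (Fin.suc Fin.zero) ›
    p₃ : ∀ {n} → Schema (suc (suc (suc (suc n))))
    p₃ = ‹ Fin.suc (Fin.suc (Fin.suc Fin.zero)) ›

    _⟨_⟩ : ∀ {n} → Schema n → Vec Fm n → Fm
    ‹ i ›    ⟨ Γ ⟩ = lookup Γ i
    (~ˢ s)   ⟨ Γ ⟩ = ~ (s ⟨ Γ ⟩)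
    (s ⇒ˢ t) ⟨ Γ ⟩ = s ⟨ Γ ⟩ ⇒ t ⟨ Γ ⟩

    ⟦_⟧ˢ : ∀ {n} → Schema n → Vec Bool n → Bool
    ⟦ ‹ i › ⟧ˢ    ρ = lookup ρ i
    ⟦ ~ˢ s ⟧ˢ     ρ = not (⟦ s ⟧ˢ ρ)
    ⟦ s ⇒ˢ t ⟧ˢ   ρ = not (⟦ s ⟧ˢ ρ) ∨ ⟦ t ⟧ˢ ρ

    eval-⟨⟩ : ∀ {n} v (s : Schema n) Γ → eval v (s ⟨ Γ ⟩) ≡ ⟦ s ⟧ˢ (map (eval v) Γ)
    eval-⟨⟩ v ‹ i ›    Γ = sym (lookup-map i (eval v) Γ)
    eval-⟨⟩ v (~ˢ s)   Γ = cong not (eval-⟨⟩ v s Γ)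
    eval-⟨⟩ v (s ⇒ˢ t) Γ = cong₂ (λ a b → not a ∨ b) (eval-⟨⟩ v s Γ) (eval-⟨⟩ v t Γ)

    allTrue : ∀ n → (Vec Bool n → Bool) → Bool
    allTrue zero    f = f []
    allTrue (suc n) f = allTrue n (f ∘ (true ∷_)) ∧ᵇ allTrue n (f ∘ (false ∷_))

    allTrue-sound : ∀ n f → T (allTrue n f) → ∀ ρ → f ρ ≡ true
    allTrue-sound zero    f t []         = Equivalence.to T-≡ t
    allTrue-sound (suc n) f t (true ∷ ρ)  = allTrue-sound n _ (proj₁ (Equivalence.to T-∧ t)) ρ
    allTrue-sound (suc n) f t (false ∷ ρ) = allTrue-sound n _ (proj₂ (Equivalence.to T-∧ t)) ρ

    Valid : ∀ {n} → Schema n → Set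
    Valid {n} s = T (allTrue n ⟦ s ⟧ˢ)

    valid⇒taut : ∀ {n} (s : Schema n) → Valid s → ∀ Γ → Taut (s ⟨ Γ ⟩)
    valid⇒taut s valid Γ v = trans (eval-⟨⟩ v s Γ) (allTrue-sound _ ⟦ s ⟧ˢ valid (map (eval v) Γ))

    -- For a closed valid schema, Valid s computes to ⊤, so the implicit proof is found by eta.
    instance-of : ∀ {X n} (s : Schema n) {valid : Valid s} Γ → X ⊢ s ⟨ Γ ⟩
    instance-of s {valid} Γ = taut (valid⇒taut s valid Γ)

  module Derivations (Λ : Sys) where
    open Tautologies

    ⊢-trans : ∀ {φ ψ χ} → Λ ⊢ (φ ⇒ ψ) → Λ ⊢ (ψ ⇒ χ) → Λ ⊢ (φ ⇒ χ)
    ⊢-trans {φ} {ψ} {χ} = mp ∘ mp (instance-of ((p₀ ⇒ˢ p₁) ⇒ˢ (p₁ ⇒ˢ p₂) ⇒ˢ p₀ ⇒ˢ p₂) (φ ∷ ψ ∷ χ ∷ []))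

    ⊢⊤ : Λ ⊢ ⊤f
    ⊢⊤ = instance-of (p₀ ⇒ˢ p₀) (var 0 ∷ [])

    ∩-∧ : ∀ {I φ ψ} → Λ ⊢ (∩[ I ] φ ⇒ ∩[ I ] ψ ⇒ ∩[ I ] (φ ∧ ψ))
    ∩-∧ {φ = φ} {ψ} = ⊢-trans (mp axK∩ (ruleN∩ (instance-of (p₀ ⇒ˢ p₁ ⇒ˢ p₀ ∧ˢ p₁) (φ ∷ ψ ∷ [])))) axK∩

    ∩-⋀ : ∀ I l → Λ ⊢ (⋀ (List.map ∩[ I ] l) ⇒ ∩[ I ] (⋀ l))
    ∩-⋀ I [] = mp (instance-of (p₀ ⇒ˢ p₁ ⇒ˢ p₀) (∩[ I ] ⊤f ∷ ⊤f ∷ [])) (ruleN∩ ⊢⊤)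
    ∩-⋀ I (φ ∷ l) = mp (mp combine ∩-∧) (∩-⋀ I l)
      where
      combine : Λ ⊢ ((∩[ I ] φ ⇒ ∩[ I ] (⋀ l) ⇒ ∩[ I ] (φ ∧ ⋀ l))
                     ⇒ (⋀ (List.map ∩[ I ] l) ⇒ ∩[ I ] (⋀ l))
                     ⇒ (∩[ I ] φ ∧ ⋀ (List.map ∩[ I ] l)) ⇒ ∩[ I ] (φ ∧ ⋀ l))
      combine = instance-of ((p₀ ⇒ˢ p₁ ⇒ˢ p₂) ⇒ˢ (p₃ ⇒ˢ p₁) ⇒ˢ p₀ ∧ˢ p₃ ⇒ˢ p₂)
                  (∩[ I ] φ ∷ ∩[ I ] (⋀ l) ∷ ∩[ I ] (φ ∧ ⋀ l) ∷ ⋀ (List.map ∩[ I ] l) ∷ [])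

    ∩｛｝⇒□ : ∀ {i φ} → Λ ⊢ (∩[ ｛ i ｝ ] φ ⇒ □ i φ)
    ∩｛｝⇒□ {i} {φ} = mp (instance-of ((p₀ ⇒ˢ p₁) ∧ˢ (p₁ ⇒ˢ p₀) ⇒ˢ p₁ ⇒ˢ p₀) (□ i φ ∷ ∩[ ｛ i ｝ ] φ ∷ [])) ax∩1

    ∩-refutation : Λ ≡ D → ∀ i {l} → Λ ⊢ (~ ⋀ l) → Λ ⊢ (~ ⋀ (List.map ∩[ ｛ i ｝ ] l))
    ∩-refutation Λ≡D i {l} ⊢¬⋀l = mp (mp contrapose ⋀∩l⇒◇⋀l) (ruleN ⊢¬⋀l)
      where
      ⋀∩l : Fm
      ⋀∩l = ⋀ (List.map ∩[ ｛ i ｝ ] l)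
      ⋀∩l⇒◇⋀l : Λ ⊢ (⋀∩l ⇒ ~ □ i (~ ⋀ l))
      ⋀∩l⇒◇⋀l = ⊢-trans (⊢-trans (∩-⋀ ｛ i ｝ l) ∩｛｝⇒□) (axD Λ≡D)
      contrapose : Λ ⊢ ((⋀∩l ⇒ ~ □ i (~ ⋀ l)) ⇒ □ i (~ ⋀ l) ⇒ ~ ⋀∩l)
      contrapose = instance-of ((p₀ ⇒ˢ ~ˢ p₁) ⇒ˢ p₁ ⇒ˢ ~ˢ p₀)
                     (⋀∩l ∷ □ i (~ ⋀ l) ∷ [])

  module Lindenbaum (em : ExcludedMiddle 0ℓ) (σ : Signature) (Γ₀ : Pred Fm 0ℓ) where

    _∪[_] : Pred Fm 0ℓ → Fm → Pred Fm 0ℓ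
    Γ ∪[ φ ] = Γ ∪ (_≡ φ)

    consistent-antimono : ∀ {Γ Δ : Pred Fm 0ℓ} → Γ ⊆ Δ → Consistent (X σ) Δ → Consistent (X σ) Γ
    consistent-antimono Γ⊆Δ con l = con l ∘ All.map Γ⊆Δ

    stage : ℕ → Pred Fm 0ℓ
    Candidate : ℕ → Pred Fm 0ℓ

    stage zero    = Γ₀
    stage (suc n) = stage n ∪ Candidate n

    Candidate n φ = code φ ≡ n × Cl σ φ × Consistent (X σ) (stage n ∪[ φ ])

    stage-suc-⊆ : ∀ {n φ} → Candidate n φ → stage (suc n) ⊆ stage n ∪[ φ ]
    stage-suc-⊆ _            (inj₁ ψ∈stage) = inj₁ ψ∈stage
    stage-suc-⊆ (code≡ , _) (inj₂ (code≡′ , _)) = inj₂ (code-injective (trans code≡′ (sym code≡)))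

    stage-consistent : Consistent (X σ) Γ₀ → ∀ n → Consistent (X σ) (stage n)
    stage-consistent con₀ zero = con₀
    stage-consistent con₀ (suc n) with em {∃ (Candidate n)}
    ... | yes (φ , cand) = consistent-antimono (stage-suc-⊆ cand) (proj₂ (proj₂ cand))
    ... | no ∄cand       = consistent-antimono only-old (stage-consistent con₀ n)
      where
      only-old : stage (suc n) ⊆ stage n
      only-old (inj₁ φ∈stage) = φ∈stage
      only-old (inj₂ cand)    = ⊥-elim (∄cand (_ , cand))

    stage-⊆-Cl : Γ₀ ⊆ Cl σ → ∀ n → stage n ⊆ Cl σ
    stage-⊆-Cl Γ₀⊆Cl zero    = Γ₀⊆Cl
    stage-⊆-Cl Γ₀⊆Cl (suc n) (inj₁ φ∈stage)    = stage-⊆-Cl Γ₀⊆Cl n φ∈stage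
    stage-⊆-Cl Γ₀⊆Cl (suc n) (inj₂ (_ , φ∈Cl , _)) = φ∈Cl

    stage-mono : ∀ {m n} → m ≤′ n → stage m ⊆ stage n
    stage-mono ≤′-refl      = id
    stage-mono (≤′-step m≤n) = inj₁ ∘ stage-mono m≤n

    Γ∞ : Pred Fm 0ℓ
    Γ∞ φ = ∃ λ n → stage n φ

    finite-⊆-stage : ∀ {l} → All Γ∞ l → ∃ λ n → All (stage n) l
    finite-⊆-stage []                  = 0 , []
    finite-⊆-stage ((m , φ∈stage) ∷ l⊆Γ∞) with finite-⊆-stage l⊆Γ∞
    ... | n , l⊆stage = m ⊔ n , stage-mono (≤⇒≤′ (m≤m⊔n m n)) φ∈stage
                              ∷ All.map (stage-mono (≤⇒≤′ (m≤n⊔m m n))) l⊆stage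

    Γ∞-⊆-Cl : Γ₀ ⊆ Cl σ → Γ∞ ⊆ Cl σ
    Γ∞-⊆-Cl Γ₀⊆Cl (n , φ∈stage) = stage-⊆-Cl Γ₀⊆Cl n φ∈stage

    Γ∞-consistent : Consistent (X σ) Γ₀ → Consistent (X σ) Γ∞
    Γ∞-consistent con₀ l l⊆Γ∞ with finite-⊆-stage l⊆Γ∞
    ... | n , l⊆stage = stage-consistent con₀ n l l⊆stage

    Γ∞-maximal : ∀ φ → Cl σ φ → Consistent (X σ) (Γ∞ ∪[ φ ]) → Γ∞ φ
    Γ∞-maximal φ φ∈Cl con =
      suc (code φ) , inj₂ (refl , φ∈Cl , consistent-antimono (Sum.map₁ (code φ ,_)) con)

    member : Fm → Bool
    member φ = ⌊ em {Γ∞ φ} ⌋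

    member⇒Γ∞ : ∀ {φ} → T (member φ) → Γ∞ φ
    member⇒Γ∞ = toWitness

    Γ∞⇒member : ∀ {φ} → Γ∞ φ → T (member φ)
    Γ∞⇒member = fromWitness

    extension : .(Γ₀ ⊆ Cl σ) → .(Consistent (X σ) Γ₀) → MCS σ
    extension Γ₀⊆Cl con₀ = mcs member
      (λ _ → Γ∞-⊆-Cl Γ₀⊆Cl ∘ member⇒Γ∞)
      (λ l → Γ∞-consistent con₀ l ∘ All.map member⇒Γ∞)
      (λ φ φ∈Cl φ∉ con → φ∉ (Γ∞⇒member (Γ∞-maximal φ φ∈Cl (consistent-antimono (Sum.map₁ Γ∞⇒member) con))))

    Γ₀-⊆-extension : Γ₀ ⊆ λ φ → T (member φ)
    Γ₀-⊆-extension φ∈Γ₀ = Γ∞⇒member (0 , φ∈Γ₀)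

  ｛｝-⊆ᵢ : ∀ {i I} → i ∈ᵢ I → ｛ i ｝ ⊆ᵢ I
  ｛｝-⊆ᵢ i∈I (here refl) = i∈I

  ∩-preimage-consistent : ∀ i {Γ : Pred Fm 0ℓ} → Consistent D Γ → Consistent D (Γ ∘ ∩[ ｛ i ｝ ])
  ∩-preimage-consistent i con l l⊆ = con _ (map⁺ l⊆) ∘ Derivations.∩-refutation D refl i

  IExt-trans : ∀ {σ i} {s t u : Path σ} → IExt i s t → IExt i t u → IExt i s u
  IExt-trans s≤t here            = s≤t
  IExt-trans s≤t (there t≤u i∈I) = there (IExt-trans s≤t t≤u) i∈I

  IExt-comparable : ∀ {σ i} {u v t : Path σ} → IExt i u t → IExt i v t → IExt i u v ⊎ IExt i v u
  IExt-comparable here              v≤t               = inj₂ v≤t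
  IExt-comparable u≤t               here              = inj₁ u≤t
  IExt-comparable (there u≤t _) (there v≤t _) = IExt-comparable u≤t v≤t

  module _ (em : ExcludedMiddle 0ℓ) where

    kripke : ∀ σ → IsKripke (StdModel σ)
    kripke σ ¬path = ¬path (start (extension (λ ()) ∅-consistent))
      where open Lindenbaum em σ ∅

    D-successor : ∀ σ → X σ ≡ D → ∀ i (Φ : MCS σ) → ∃ (Canon σ ｛ i ｝ Φ)
    D-successor σ@record { X = _ } refl i Φ@(mcs _ Φ⊆Cl Φ-consistent _) =
      extension (λ φ∈ → c-sub (Φ⊆Cl _ φ∈) s∩) (∩-preimage-consistent i Φ-consistent) , λ _ → Γ₀-⊆-extension
      where open Lindenbaum em σ ((_∈Φ Φ) ∘ ∩[ ｛ i ｝ ])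

    D-model : ∀ σ → X σ ≡ D → IsDModel (ι σ) (StdModel σ)
    D-model σ@record { X = _ } refl = kripke σ , serial
      where
      serial : ∀ i → i ∈ᵢ ι σ → Serial (StdRel σ i)
      serial i i∈ι s with D-successor σ refl i (tail s)
      ... | Ψ , s▷Ψ = step s ｛ i ｝ (｛｝-⊆ᵢ {I = ι σ} i∈ι) Ψ s▷Ψ , os (here refl)

    T-model : ∀ σ → X σ ≡ T′ → IsTModel (ι σ) (StdModel σ)
    T-model σ@record { X = _ } refl = kripke σ , λ _ _ → inj₁ refl

    B-model : ∀ σ → X σ ≡ B → IsBModel (ι σ) (StdModel σ)
    B-model σ@record { X = _ } refl = kripke σ , λ _ _ → inj₁ refl , symmetric
      where
      symmetric : ∀ {i s t} → StdRel σ i s t → StdRel σ i t s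
      symmetric (inj₁ s≡t)        = inj₁ (sym s≡t)
      symmetric (inj₂ (inj₁ t→s)) = inj₂ (inj₂ t→s)
      symmetric (inj₂ (inj₂ s→t)) = inj₂ (inj₁ s→t)

    S4-model : ∀ σ → X σ ≡ S4 → IsS4Model (ι σ) (StdModel σ)
    S4-model σ@record { X = _ } refl = kripke σ , λ _ _ → here , IExt-trans

    S5-model : ∀ σ → X σ ≡ S5 → IsS5Model (ι σ) (StdModel σ)
    S5-model σ@record { X = _ } refl = kripke σ , λ _ _ → record
      { refl  = _ , here , here
      ; sym   = λ { (u , u≤s , u≤t) → u , u≤t , u≤s }
      ; trans = transitive
      }
      where
      transitive : ∀ {i s t w} → StdRel σ i s t → StdRel σ i t w → StdRel σ i s w
      transitive (u , u≤s , u≤t) (v , v≤t , v≤w) with IExt-comparable u≤t v≤t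
      ... | inj₁ u≤v = u , u≤s , IExt-trans u≤v v≤w
      ... | inj₂ v≤u = v , IExt-trans v≤u u≤s , v≤w

lemma4 : ExcludedMiddle 0ℓ →
    (𝕀 : Set) (enc : 𝕀 → ℕ) (enc-inj : ∀ {x y} → enc x ≡ enc y → x ≡ y) →
    let open Defs.L 𝕀 enc enc-inj in
    (σ : Signature) →
      IsKripke (StdModel σ)
      × (X σ ≡ D → IsDModel (ι σ) (StdModel σ))
      × (X σ ≡ T′ → IsTModel (ι σ) (StdModel σ))
      × (X σ ≡ B → IsBModel (ι σ) (StdModel σ))
      × (X σ ≡ S4 → IsS4Model (ι σ) (StdModel σ))
      × (X σ ≡ S5 → IsS5Model (ι σ) (StdModel σ))
lemma4 em 𝕀 enc enc-inj σ =
  kripke em σ , D-model em σ , T-model em σ , B-model em σ , S4-model em σ , S5-model em σ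
  where open FinitaryStandardModel 𝕀 enc enc-inj
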